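{- Let $\Delta$ be a positive integer and let $\mathcal{A}$ be Algorithm $\mathcal{A}(-1,\Delta+1)$ (defined in the context). Let $\mathcal{I}$ be any finite set of closed unit-length intervals each contained in $[0,\Delta)$, and let $OPT\subseteq\mathcal{I}$ be a maximum independent subset of $\mathcal{I}$. Then $$\mathbb{E}_{S_{OPT}\sim\Pi(OPT)}|OUT(\mathcal{A}(S_{OPT}))|\le\mathbb{E}_{S_{\mathcal{I}}\sim\Pi(\mathcal{I})}|OUT(\mathcal{A}(S_{\mathcal{I}}))|,$$ where $\Pi(X)$ denotes the uniform distribution over orderings (permutations) of the set $X$ and $OUT(\mathcal{A}(S))$ is the output of the algorithm on stream $S$.
   Context: For closed intervals $I=[a_I,b_I]$, $J=[a_J,b_J]$: $I$ is further left than $J$ if $a_I<a_J$; $I$ is further right than $J$ if $b_I>b_J$; $I,J$ are independent if $I\cap J=\varnothing$. Algorithm $\mathcal{A}(a,b)$, for integers $a<b$, processes a stream of closed unit-length intervals each contained in $[a,b)$. At initialisation, for each integer $i\in\{a+1,\dots,b-1\}$ it sets $L_i\gets\emptyset$, $R_i\gets\emptyset$ and creates recursive instances $\mathcal{T}^L_i$, $\mathcal{A}^L_i$ of $\mathcal{A}(a,i)$ and $\mathcal{T}^R_i$, $\mathcal{A}^R_i$ of $\mathcal{A}(i,b)$. When an interval $I$ arrives, for each such $i$: if $I\subseteq[i,b)$: feed $I$ into $\mathcal{T}^R_i$; if $R_i=\emptyset$ or $I$ is further left than $R_i$, set $R_i\gets I$; then if $R_i\ne\emptyset$, $I$ is independent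 of $R_i$ and further right than $R_i$, feed $I$ into $\mathcal{A}^R_i$. If $I\subseteq[a,i)$: feed $I$ into $\mathcal{T}^L_i$; if $L_i=\emptyset$ or $I$ is further right than $L_i$, set $L_i\gets I$; then if $L_i\ne\emptyset$, $I$ is independent of $L_i$ and further left than $L_i$, feed $I$ into $\mathcal{A}^L_i$. The output is a largest set among $OUT(\mathcal{T}^L_i)\cup R_i\cup OUT(\mathcal{A}^R_i)$ and $OUT(\mathcal{A}^L_i)\cup L_i\cup OUT(\mathcal{T}^R_i)$ over all $i\in\{a+1,\dots,b-1\}$ (empty variables contribute nothing; empty output if no such $i$).
   Formalization: Every unit-length interval, both in $\mathcal{I}$ and in the streams fed to the algorithm, has rational endpoints. -}

module Defs where

open import Data.Nat as ℕ using (ℕ; zero; suc; _∸_)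
open import Data.Integer as ℤ using (ℤ; +_; -[1+_])
open import Data.Rational using (ℚ; _/_; _<_; _≤_; _+_; 0ℚ; 1ℚ)
open import Data.Rational.Properties using (_<?_; _≤?_) renaming (_≟_ to _≟ℚ_)
open import Data.List using (List; []; _∷_; _++_; map; filter; concatMap; length; upTo; deduplicate)
open import Data.Nat.ListAction using (sum)
open import Data.List.Membership.Propositional using (_∈_)
open import Data.List.Relation.Unary.All using (All)
open import Data.List.Relation.Unary.AllPairs using (AllPairs)
open import Data.List.Relation.Unary.Unique.Propositional using (Unique)
open import Data.Maybe using (Maybe; just; nothing)
open import Data.Product using (_×_; _,_; proj₁; proj₂)
open import Data.Sum using (_⊎_)
open import Data.Bool using (Bool; true; false; if_then_else_; _∧_; _∨_; not)
open import Relation.Nullary using (Dec; yes; no; does)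
open import Relation.Nullary.Decidable using (_×-dec_; _⊎-dec_; map′)
open import Relation.Binary.PropositionalEquality using (_≡_; refl; cong)
open import Relation.Binary.Definitions using (DecidableEquality)

-- Closed unit-length intervals [lo, lo + 1] with rational endpoints.

record UnitInterval : Set where
  constructor ⟦_⟧
  field lo : ℚ
open UnitInterval public

hi : UnitInterval → ℚ
hi I = lo I + 1ℚ

_≟I_ : DecidableEquality UnitInterval
⟦ x ⟧ ≟I ⟦ y ⟧ = map′ (cong ⟦_⟧) (cong lo) (x ≟ℚ y)

FurtherLeft : UnitInterval → UnitInterval → Set
FurtherLeft I J = lo I < lo J

FurtherRight : UnitInterval → UnitInterval → Set
FurtherRight I J = hi J < hi I

Independent : UnitInterval → UnitInterval → Set
Independent I J = (hi I < lo J) ⊎ (hi J < lo I)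

InsideCO : ℚ → ℚ → UnitInterval → Set
InsideCO x y I = (x ≤ lo I) × (hi I < y)

furtherLeft? : ∀ I J → Dec (FurtherLeft I J)
furtherLeft? I J = lo I <? lo J

furtherRight? : ∀ I J → Dec (FurtherRight I J)
furtherRight? I J = hi J <? hi I

independent? : ∀ I J → Dec (Independent I J)
independent? I J = (hi I <? lo J) ⊎-dec (hi J <? lo I)

insideCO? : ∀ x y I → Dec (InsideCO x y I)
insideCO? x y I = (x ≤? lo I) ×-dec (hi I <? y)

ℤtoℚ : ℤ → ℚ
ℤtoℚ z = z / 1

-- Algorithm A(a,b), written as a function of the whole stream.

maybeToList : {A : Set} → Maybe A → List A
maybeToList nothing = []
maybeToList (just x) = x ∷ []

-- Right side for split point i (interval [i,b)):
-- returns the final R_i and the substream fed to A^R_i.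
rightSide : ℚ → ℚ → Maybe UnitInterval → List UnitInterval →
            Maybe UnitInterval × List UnitInterval
rightSide i b R [] = R , []
rightSide i b R (I ∷ S) with does (insideCO? i b I)
... | false = rightSide i b R S
... | true =
  let R′ = newR R
      rest = rightSide i b R′ S
  in proj₁ rest , (feed R′ ++ proj₂ rest)
  where
  newR : Maybe UnitInterval → Maybe UnitInterval
  newR nothing = just I
  newR (just J) = if does (furtherLeft? I J) then just I else just J
  feed : Maybe UnitInterval → List UnitInterval
  feed nothing = []
  feed (just J) = if does (independent? I J) ∧ does (furtherRight? I J)
                  then I ∷ [] else []

-- Left side for split point i (interval [a,i)):
-- returns the final L_i and the substream fed to A^L_i.
leftSide : ℚ → ℚ → Maybe UnitInterval → List UnitInterval →
           Maybe UnitInterval × List UnitInterval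
leftSide a i L [] = L , []
leftSide a i L (I ∷ S) with does (insideCO? a i I)
... | false = leftSide a i L S
... | true =
  let L′ = newL L
      rest = leftSide a i L′ S
  in proj₁ rest , (feed L′ ++ proj₂ rest)
  where
  newL : Maybe UnitInterval → Maybe UnitInterval
  newL nothing = just I
  newL (just J) = if does (furtherRight? I J) then just I else just J
  feed : Maybe UnitInterval → List UnitInterval
  feed nothing = []
  feed (just J) = if does (independent? I J) ∧ does (furtherLeft? I J)
                  then I ∷ [] else []

restrict : ℚ → ℚ → List UnitInterval → List UnitInterval
restrict x y = filter (insideCO? x y)

union : List UnitInterval → List UnitInterval
union = deduplicate _≟I_

-- a largest set in a list of candidates (earliest one on ties); [] if none
largest : List (List UnitInterval) → List UnitInterval
largest [] = []
largest (c ∷ cs) with largest cs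
... | m = if does (length m ℕ.≤? length c) then c else m

-- alg f a d S : output of A(a, a + d) on stream S, with fuel f ≥ d.
-- Split points i = a + k for k ∈ {1, …, d-1}; the left instances are
-- A(a, a+k) (width k) and the right ones A(a+k, a+d) (width d-k).
alg : ℕ → ℤ → ℕ → List UnitInterval → List UnitInterval
alg zero a d S = []
alg (suc f) a d S = largest (concatMap cands (map suc (upTo (d ∸ 1))))
  where
  b : ℤ
  b = a ℤ.+ + d
  cands : ℕ → List (List UnitInterval)
  cands k =
    let i = a ℤ.+ + k
        aq = ℤtoℚ a
        iq = ℤtoℚ i
        bq = ℤtoℚ b
        TL = restrict aq iq S
        TR = restrict iq bq S
        RS = rightSide iq bq nothing S
        LS = leftSide aq iq nothing S
    in union (alg f a k TL ++ maybeToList (proj₁ RS) ++ alg f i (d ∸ k) (proj₂ RS))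
     ∷ union (alg f a k (proj₂ LS) ++ maybeToList (proj₁ LS) ++ alg f i (d ∸ k) TR)
     ∷ []

algorithmA : (a b : ℤ) → List UnitInterval → List UnitInterval
algorithmA a b S = alg (ℤ.∣ b ℤ.- a ∣) a (ℤ.∣ b ℤ.- a ∣) S

-- Uniform distribution over orderings

insertAll : {A : Set} → A → List A → List (List A)
insertAll x [] = (x ∷ []) ∷ []
insertAll x (y ∷ ys) = (x ∷ y ∷ ys) ∷ map (y ∷_) (insertAll x ys)

-- all orderings of a list (each ordering once when the list has no duplicates)
orderings : {A : Set} → List A → List (List A)
orderings [] = [] ∷ []
orderings (x ∷ xs) = concatMap (insertAll x) (orderings xs)

mean : List ℕ → ℚ
mean [] = 0ℚ
mean (x ∷ xs) = (+ sum (x ∷ xs)) / suc (length xs)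

expectedOut : (List UnitInterval → List UnitInterval) → List UnitInterval → ℚ
expectedOut alg X = mean (map (λ S → length (alg S)) (orderings X))

IndependentSubset : List UnitInterval → List UnitInterval → Set
IndependentSubset 𝓘 X = Unique X × All (_∈ 𝓘) X × AllPairs Independent X

MaximumIndependentSubset : List UnitInterval → List UnitInterval → Set
MaximumIndependentSubset 𝓘 OPT =
  IndependentSubset 𝓘 OPT ×
  (∀ X → IndependentSubset 𝓘 X → length X ℕ.≤ length OPT)

-- The algorithm is monotone along subsequences: if S′ is a subsequence of S then
-- |OUT(A(S′))| ≤ |OUT(A(S))|.  By induction on the recursion no candidate is larger for S′ than
-- for S: the streams of the recursive instances shrink to subsequences, the champion R_i (or L_i)
-- computed from S′ is never better than the one computed from S, so every interval that S′ feeds to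
-- A^R_i (or A^L_i) is also fed by S; and for S the three parts of a candidate are disjoint, so their
-- union loses nothing.
--
-- Restricting a uniformly random ordering of 𝓘 to OPT gives a uniformly random ordering of OPT:
-- with the intervals outside OPT listed first, each of them is inserted into an ordering of the rest
-- in the same number of ways.  Hence
-- E|OUT(A(S_OPT))| = E|OUT(A(S_𝓘 restricted to OPT))| ≤ E|OUT(A(S_𝓘))|.

module Submission where

open import Defs
open import Data.Nat as ℕ using (ℕ; zero; suc; _∸_; _≤_; _<_; _+_; _*_; _⊔_; z≤n; s≤s)
import Data.Nat.Properties as ℕ
open import Data.Nat.ListAction using (sum)
open import Data.Nat.ListAction.Properties using (sum-++)
open import Data.Nat.Tactic.RingSolver using (solve-∀)
open import Algebra.Properties.CommutativeSemigroup ℕ.+-commutativeSemigroup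
  using () renaming (interchange to +-interchange)
open import Data.Integer as ℤ using (ℤ; +_; -[1+_])
import Data.Integer.Properties as ℤ
open import Data.Rational as ℚ using (ℚ; 1ℚ) renaming (_≤_ to _≤ℚ_; _<_ to _<ℚ_)
import Data.Rational.Properties as ℚ
open import Data.Rational.Unnormalised as ℚᵘ using (mkℚᵘ; *≡*; *≤*)
import Data.Rational.Unnormalised.Properties as ℚᵘ
open import Data.List using (List; []; _∷_; _++_; map; concatMap; length; upTo; filter)
open import Data.List.Properties
  using ( length-++; length-map; length-++-≤ˡ; ++-assoc; map-++; map-∘; map-cong; map-cong-local
        ; concatMap-cong; filter-all; filter-reject)
open import Data.List.Membership.Propositional using (_∈_; _∉_)
open import Data.List.Membership.Propositional.Properties using (∈-filter⁺; ∈-filter⁻)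
open import Data.List.Membership.Propositional.Properties.WithK using (unique∧set⇒bag)
open import Data.List.Membership.DecPropositional _≟I_ using (_∈?_)
open import Data.List.Relation.Unary.Any using (here)
open import Data.List.Relation.Unary.All as All using (All; []; _∷_)
import Data.List.Relation.Unary.All.Properties as AllP
open import Data.List.Relation.Unary.Unique.Propositional using (Unique; []; _∷_)
import Data.List.Relation.Unary.Unique.Propositional.Properties as Unique
open import Data.List.Relation.Unary.Unique.DecPropositional.Properties _≟I_ using (deduplicate-!)
open import Data.List.Relation.Binary.Disjoint.Propositional using (Disjoint)
import Data.List.Relation.Binary.Disjoint.Propositional.Properties as Disjoint
open import Data.List.Relation.Binary.Pointwise as Pointwise using (Pointwise; []; _∷_)
import Data.List.Relation.Binary.Pointwise.Properties as Pointwise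
open import Data.List.Relation.Binary.Sublist.Propositional
  using (_⊆_; []; _∷_; _∷ʳ_; minimum; ⊆-refl; ⊆-reflexive; ⊆-trans)
open import Data.List.Relation.Binary.Sublist.Propositional.Properties
  using (++⁺; ++⁺ˡ; filter-⊆; filter⁺; length-mono-≤; All-resp-⊆)
open import Data.List.Relation.Binary.Permutation.Propositional as ↭
  using (_↭_; ↭-refl; ↭-sym; ↭-trans; ↭-prep; ↭-swap)
open import Data.List.Relation.Binary.Permutation.Propositional.Properties using (shift; All-resp-↭; ↭-length)
open import Data.List.Relation.Binary.BagAndSetEquality using (∼bag⇒↭)
open import Data.Maybe using (Maybe; just; nothing)
open import Data.Product using (_×_; _,_; proj₁; proj₂; map₂; ∃-syntax)
open import Data.Sum using (_⊎_; inj₁; inj₂; swap; [_,_]′)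
open import Data.Bool using (true; false; if_then_else_; _∧_)
open import Function using (_∘_; _⇔_; mk⇔; Equivalence; id; flip)
open import Level using (0ℓ)
open import Relation.Nullary using (yes; no; does; ¬_; contradiction)
open import Relation.Nullary.Decidable using (dec-true; dec-false)
open import Relation.Unary using (Pred; Decidable; ∁)
open import Relation.Unary.Properties using (∁?)
import Relation.Binary as B
open import Relation.Binary using (Rel; Transitive; Cotransitive)
open import Relation.Binary.PropositionalEquality
  using (_≡_; refl; sym; trans; cong; cong₂; subst; subst₂; module ≡-Reasoning)

lo<hi : ∀ I → lo I <ℚ hi I
lo<hi I = ℚ.<-respˡ-≡ (ℚ.+-identityʳ (lo I)) (ℚ.+-monoʳ-< (lo I) (ℚ.positive⁻¹ 1ℚ))

hi-mono-≤ : ∀ {I J} → lo I ≤ℚ lo J → hi I ≤ℚ hi J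
hi-mono-≤ = ℚ.+-monoˡ-≤ 1ℚ

hi-mono-< : ∀ {I J} → lo I <ℚ lo J → hi I <ℚ hi J
hi-mono-< = ℚ.+-monoˡ-< 1ℚ

hi-cancel-≤ : ∀ {I J} → hi I ≤ℚ hi J → lo I ≤ℚ lo J
hi-cancel-≤ {I} {J} hI≤hJ =
  ℚ.≮⇒≥ (λ lJ<lI → ℚ.<-irrefl refl (ℚ.<-≤-trans (hi-mono-< {J} {I} lJ<lI) hI≤hJ))

hi-cancel-< : ∀ {I J} → hi I <ℚ hi J → lo I <ℚ lo J
hi-cancel-< {I} {J} hI<hJ =
  ℚ.≰⇒> (λ lJ≤lI → ℚ.<-irrefl refl (ℚ.<-≤-trans hI<hJ (hi-mono-≤ {J} {I} lJ≤lI)))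

<-cotrans : Cotransitive _<ℚ_
<-cotrans {x} {y} x<y z with x ℚ.<? z
... | yes x<z = inj₁ x<z
... | no  x≮z = inj₂ (ℚ.≤-<-trans (ℚ.≮⇒≥ x≮z) x<y)

-- For a split point i of A(a,b), R_i is the champion (the ≺-best interval so far, ≺ = FurtherLeft)
-- of the intervals inside [i,b), and an interval is fed to A^R_i when it is independent of, and
-- Beyond (= FurtherRight), the champion at its arrival.  L_i is the same process on [a,i) with the
-- two relations exchanged.
module Champion
  {_≺_ : Rel UnitInterval 0ℓ} (better? : B.Decidable _≺_)
  (≺-irrefl : ∀ {I} → ¬ I ≺ I) (≺-trans : Transitive _≺_) (≺-cotrans : Cotransitive _≺_)
  {Beyond : Rel UnitInterval 0ℓ} (beyond? : B.Decidable Beyond)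
  (beyond⇔ : ∀ {I J} → Beyond I J ⇔ J ≺ I)
  (independent-≺ : ∀ {I J K} → ¬ J ≺ K → J ≺ I → Independent I J → Independent I K)
  where

  step : UnitInterval → Maybe UnitInterval → Maybe UnitInterval
  step I nothing  = just I
  step I (just J) = if does (better? I J) then just I else just J

  feed : UnitInterval → Maybe UnitInterval → List UnitInterval
  feed I nothing  = []
  feed I (just J) = if does (independent? I J) ∧ does (beyond? I J) then I ∷ [] else []

  champion : Maybe UnitInterval → List UnitInterval → Maybe UnitInterval
  champion C []      = C
  champion C (I ∷ S) = champion (step I C) S

  fed : Maybe UnitInterval → List UnitInterval → List UnitInterval
  fed C []      = []
  fed C (I ∷ S) = feed I (step I C) ++ fed (step I C) S

  ⊀-≺-trans : ∀ {J K I} → ¬ J ≺ K → J ≺ I → K ≺ I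
  ⊀-≺-trans J⊀K J≺I = [ flip contradiction J⊀K , id ]′ (≺-cotrans J≺I _)

  infix 4 _≼_
  data _≼_ : Maybe UnitInterval → Maybe UnitInterval → Set where
    nothing≼  : ∀ {C} → nothing ≼ C
    just≼just : ∀ {J K} → ¬ J ≺ K → just J ≼ just K

  ≼-refl : ∀ {C} → C ≼ C
  ≼-refl {nothing} = nothing≼
  ≼-refl {just J}  = just≼just ≺-irrefl

  ≼-trans : ∀ {C D E} → C ≼ D → D ≼ E → C ≼ E
  ≼-trans nothing≼         _               = nothing≼
  ≼-trans (just≼just J⊀K) (just≼just K⊀L) = just≼just λ J≺L →
    [ J⊀K , K⊀L ]′ (≺-cotrans J≺L _)

  ≼-length : ∀ {C D} → C ≼ D → length (maybeToList C) ≤ length (maybeToList D)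
  ≼-length nothing≼      = z≤n
  ≼-length (just≼just _) = s≤s z≤n

  ≼-step : ∀ I C → C ≼ step I C
  ≼-step I nothing = nothing≼
  ≼-step I (just J) with better? I J
  ... | yes I≺J = just≼just λ J≺I → ≺-irrefl (≺-trans I≺J J≺I)
  ... | no  _   = ≼-refl

  just≼step : ∀ I C → just I ≼ step I C
  just≼step I nothing = ≼-refl
  just≼step I (just J) with better? I J
  ... | yes _   = ≼-refl
  ... | no  I⊀J = just≼just I⊀J

  step-mono : ∀ I {C D} → C ≼ D → step I C ≼ step I D
  step-mono I {D = D} nothing≼ = just≼step I D
  step-mono I {just J} {just K} (just≼just J⊀K) with better? I J
  ... | yes _ = just≼step I (just K)
  ... | no  _ = ≼-trans (just≼just J⊀K) (≼-step I (just K))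

  feed-⊆ : ∀ I C → feed I C ⊆ I ∷ []
  feed-⊆ I nothing  = minimum _
  feed-⊆ I (just J) with does (independent? I J) ∧ does (beyond? I J)
  ... | true  = ⊆-refl
  ... | false = minimum _

  feed-accepts : ∀ {I J} → Independent I J → Beyond I J → feed I (just J) ≡ I ∷ []
  feed-accepts {I} {J} I⊥J I≻J =
    cong₂ (λ a b → if a ∧ b then I ∷ [] else []) (dec-true (independent? I J) I⊥J) (dec-true (beyond? I J) I≻J)

  feed-view : ∀ I J → feed I (just J) ≡ [] ⊎ (Independent I J × Beyond I J)
  feed-view I J with independent? I J
  ... | no I⊥̸J = inj₁ (cong (λ a → if a ∧ does (beyond? I J) then I ∷ [] else [])
                          (dec-false (independent? I J) I⊥̸J))
  ... | yes I⊥J with beyond? I J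
  ...   | yes I≻J = inj₂ (I⊥J , I≻J)
  ...   | no _    = inj₁ (cong (λ a → if a ∧ false then I ∷ [] else []) (dec-true (independent? I J) I⊥J))

  feed-mono : ∀ I {C D} → C ≼ D → feed I C ⊆ feed I D
  feed-mono I nothing≼ = minimum _
  feed-mono I {just J} {just K} (just≼just J⊀K) with feed-view I J
  ... | inj₁ rejected = subst (_⊆ feed I (just K)) (sym rejected) (minimum _)
  ... | inj₂ (I⊥J , I≻J) =
    ⊆-reflexive (trans (feed-accepts I⊥J I≻J) (sym (feed-accepts I⊥K (Equivalence.from beyond⇔ K≺I))))
    where
    J≺I = Equivalence.to beyond⇔ I≻J
    K≺I = ⊀-≺-trans J⊀K J≺I
    I⊥K = independent-≺ J⊀K J≺I I⊥J

  feed-∉ : ∀ I C {D} → C ≼ D → All (_∉ maybeToList D) (feed I C)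
  feed-∉ I nothing  _    = []
  feed-∉ I (just J) J≼D with feed-view I J
  ... | inj₁ rejected    = subst (All _) (sym rejected) []
  ... | inj₂ (I⊥J , I≻J) = subst (All _) (sym (feed-accepts I⊥J I≻J)) (beaten (Equivalence.to beyond⇔ I≻J) J≼D ∷ [])
    where
    beaten : ∀ {D} → J ≺ I → just J ≼ D → I ∉ maybeToList D
    beaten J≺I (just≼just J⊀K) (here refl) = J⊀K J≺I

  champion-improves : ∀ C S → C ≼ champion C S
  champion-improves C []      = ≼-refl
  champion-improves C (I ∷ S) = ≼-trans (≼-step I C) (champion-improves (step I C) S)

  champion-mono : ∀ {q p C D} → q ⊆ p → C ≼ D → champion C q ≼ champion D p
  champion-mono []                         C≼D = C≼D
  champion-mono {D = D} (I ∷ʳ q⊆p)         C≼D = champion-mono q⊆p (≼-trans C≼D (≼-step I D))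
  champion-mono {p = I ∷ _} (refl ∷ q⊆p)   C≼D = champion-mono q⊆p (step-mono I C≼D)

  fed-mono : ∀ {q p C D} → q ⊆ p → C ≼ D → fed C q ⊆ fed D p
  fed-mono []                       C≼D = []
  fed-mono {D = D} (I ∷ʳ q⊆p)       C≼D = ++⁺ˡ (feed I (step I D)) (fed-mono q⊆p (≼-trans C≼D (≼-step I D)))
  fed-mono {p = I ∷ _} (refl ∷ q⊆p) C≼D = ++⁺ (feed-mono I (step-mono I C≼D)) (fed-mono q⊆p (step-mono I C≼D))

  fed-⊆ : ∀ C S → fed C S ⊆ S
  fed-⊆ C []      = []
  fed-⊆ C (I ∷ S) = ++⁺ (feed-⊆ I (step I C)) (fed-⊆ (step I C) S)

  All-champion : ∀ {P : UnitInterval → Set} {C S} →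
                 All P (maybeToList C) → All P S → All P (maybeToList (champion C S))
  All-champion PC []        = PC
  All-champion PC (PI ∷ PS) = All-champion (All-step PI PC) PS
    where
    All-step : ∀ {P : UnitInterval → Set} {I C} → P I → All P (maybeToList C) → All P (maybeToList (step I C))
    All-step {C = nothing} PI _ = PI ∷ []
    All-step {I = I} {just J} PI PJ with better? I J
    ... | yes _ = PI ∷ []
    ... | no  _ = PJ

  champion-∉-fed : ∀ C S → All (_∉ maybeToList (champion C S)) (fed C S)
  champion-∉-fed C []      = []
  champion-∉-fed C (I ∷ S) =
    AllP.++⁺ (feed-∉ I (step I C) (champion-improves (step I C) S)) (champion-∉-fed (step I C) S)

independent-furtherLeft : ∀ {I J K} → ¬ lo J <ℚ lo K → lo J <ℚ lo I → Independent I J → Independent I K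
independent-furtherLeft {I} _ lJ<lI (inj₁ hI<lJ) = contradiction (ℚ.<-trans hI<lJ lJ<lI) (ℚ.<-asym (lo<hi I))
independent-furtherLeft {J = J} {K} J⊀K _ (inj₂ hJ<lI) = inj₂ (ℚ.≤-<-trans (hi-mono-≤ {K} {J} (ℚ.≮⇒≥ J⊀K)) hJ<lI)

independent-furtherRight : ∀ {I J K} → ¬ hi K <ℚ hi J → hi I <ℚ hi J → Independent I J → Independent I K
independent-furtherRight {J = J} {K} J⊀K _ (inj₁ hI<lJ) = inj₁ (ℚ.<-≤-trans hI<lJ (hi-cancel-≤ {J} {K} (ℚ.≮⇒≥ J⊀K)))
independent-furtherRight {I} _ hI<hJ (inj₂ hJ<lI) = contradiction (ℚ.<-trans hJ<lI (lo<hi I)) (ℚ.<-asym hI<hJ)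

module Right = Champion furtherLeft? (ℚ.<-irrefl refl) ℚ.<-trans (λ I<J K → <-cotrans I<J (lo K))
  furtherRight? (mk⇔ hi-cancel-< hi-mono-<) independent-furtherLeft

module Left = Champion furtherRight? (ℚ.<-irrefl refl) (flip ℚ.<-trans) (λ I≻J K → swap (<-cotrans I≻J (hi K)))
  furtherLeft? (mk⇔ hi-mono-< hi-cancel-<) independent-furtherRight

rightSide-restrict : ∀ i b C S →
  rightSide i b C S ≡ (Right.champion C (restrict i b S) , Right.fed C (restrict i b S))
rightSide-restrict i b C [] = refl
rightSide-restrict i b nothing (I ∷ S) with does (insideCO? i b I)
... | false = rightSide-restrict i b nothing S
... | true  = cong (map₂ (_ ++_)) (rightSide-restrict i b (just I) S)
rightSide-restrict i b (just J) (I ∷ S) with does (insideCO? i b I)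
... | false = rightSide-restrict i b (just J) S
... | true with furtherLeft? I J
...   | yes I≺J rewrite dec-true (furtherLeft? I J) I≺J = cong (map₂ (_ ++_)) (rightSide-restrict i b (just I) S)
...   | no I⊀J rewrite dec-false (furtherLeft? I J) I⊀J = cong (map₂ (_ ++_)) (rightSide-restrict i b (just J) S)

leftSide-restrict : ∀ a i C S →
  leftSide a i C S ≡ (Left.champion C (restrict a i S) , Left.fed C (restrict a i S))
leftSide-restrict a i C [] = refl
leftSide-restrict a i nothing (I ∷ S) with does (insideCO? a i I)
... | false = leftSide-restrict a i nothing S
... | true  = cong (map₂ (_ ++_)) (leftSide-restrict a i (just I) S)
leftSide-restrict a i (just J) (I ∷ S) with does (insideCO? a i I)
... | false = leftSide-restrict a i (just J) S
... | true with furtherRight? I J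
...   | yes I≻J rewrite dec-true (furtherRight? I J) I≻J = cong (map₂ (_ ++_)) (leftSide-restrict a i (just I) S)
...   | no I⊁J rewrite dec-false (furtherRight? I J) I⊁J = cong (map₂ (_ ++_)) (leftSide-restrict a i (just J) S)

-- Monotonicity of A(a,b) along subsequences

union-⊆ : ∀ xs → union xs ⊆ xs
union-⊆ []       = []
union-⊆ (x ∷ xs) = refl ∷ ⊆-trans (filter-⊆ _ _) (union-⊆ xs)

union-id : ∀ {xs} → Unique xs → union xs ≡ xs
union-id []             = refl
union-id {x ∷ xs} (x∉xs ∷ xs!) =
  cong (x ∷_) (trans (cong (filter _) (union-id xs!)) (filter-all _ x∉xs))

combine : List UnitInterval → Maybe UnitInterval → List UnitInterval → List UnitInterval
combine A m C = union (A ++ maybeToList m ++ C)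

length-++³ : ∀ (A m C : List UnitInterval) → length (A ++ m ++ C) ≡ length A + (length m + length C)
length-++³ A m C = trans (length-++ A) (cong (λ n → length A + n) (length-++ m))

combine-mono : ∀ {A m C A′ m′ C′} →
  length A ≤ length A′ → length (maybeToList m) ≤ length (maybeToList m′) → length C ≤ length C′ →
  Unique (A′ ++ maybeToList m′ ++ C′) → length (combine A m C) ≤ length (combine A′ m′ C′)
combine-mono {A} {m} {C} {A′} {m′} {C′} A≤A′ m≤m′ C≤C′ parts! = begin
  length (combine A m C)                      ≤⟨ length-mono-≤ (union-⊆ (A ++ maybeToList m ++ C)) ⟩
  length (A ++ maybeToList m ++ C)            ≡⟨ length-++³ A _ C ⟩
  length A + (length (maybeToList m) + length C)
    ≤⟨ ℕ.+-mono-≤ A≤A′ (ℕ.+-mono-≤ m≤m′ C≤C′) ⟩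
  length A′ + (length (maybeToList m′) + length C′) ≡⟨ length-++³ A′ _ C′ ⟨
  length (A′ ++ maybeToList m′ ++ C′)         ≡⟨ cong length (union-id parts!) ⟨
  length (combine A′ m′ C′)                   ∎
  where open ℕ.≤-Reasoning

All-combine : ∀ {P : UnitInterval → Set} {A m C} →
  All P A → All P (maybeToList m) → All P C → All P (combine A m C)
All-combine PA Pm PC = AllP.deduplicate⁺ _≟I_ (AllP.++⁺ PA (AllP.++⁺ Pm PC))

length-largest : ∀ c cs → length (largest (c ∷ cs)) ≡ length c ⊔ length (largest cs)
length-largest c cs with length (largest cs) ℕ.≤? length c
... | yes m≤c rewrite dec-true (length (largest cs) ℕ.≤? length c) m≤c = sym (ℕ.m≥n⇒m⊔n≡m m≤c)
... | no  m≰c rewrite dec-false (length (largest cs) ℕ.≤? length c) m≰c =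
  sym (ℕ.m≤n⇒m⊔n≡n (ℕ.<⇒≤ (ℕ.≰⇒> m≰c)))

largest-mono : ∀ {cs ds} → Pointwise (λ c d → length c ≤ length d) cs ds →
               length (largest cs) ≤ length (largest ds)
largest-mono [] = z≤n
largest-mono {c ∷ cs} {d ∷ ds} (c≤d ∷ cs≤ds)
  rewrite length-largest c cs | length-largest d ds = ℕ.⊔-mono-≤ c≤d (largest-mono cs≤ds)

largest-preserves : ∀ {P : List UnitInterval → Set} {cs} → P [] → All P cs → P (largest cs)
largest-preserves P[] [] = P[]
largest-preserves {cs = c ∷ cs} P[] (Pc ∷ Pcs) with length (largest cs) ℕ.≤? length c
... | yes m≤c rewrite dec-true (length (largest cs) ℕ.≤? length c) m≤c = Pc
... | no  m≰c rewrite dec-false (length (largest cs) ℕ.≤? length c) m≰c = largest-preserves P[] Pcs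

maybe-unique : ∀ (m : Maybe UnitInterval) → Unique (maybeToList m)
maybe-unique nothing  = []
maybe-unique (just _) = [] ∷ []

All∉⇒Disjoint : ∀ {xs ys : List UnitInterval} → All (_∉ ys) xs → Disjoint xs ys
All∉⇒Disjoint xs∉ys (v∈xs , v∈ys) = All.lookup xs∉ys v∈xs v∈ys

InsideCO-disjoint : ∀ {x y z A B} → All (InsideCO x y) A → All (InsideCO y z) B → Disjoint A B
InsideCO-disjoint A⊆xy B⊆yz (v∈A , v∈B) with All.lookup A⊆xy v∈A | All.lookup B⊆yz v∈B
... | _ , hv<y | y≤lv , _ = ℚ.<-irrefl refl (ℚ.<-trans (ℚ.≤-<-trans y≤lv (lo<hi _)) hv<y)

Monotone : (List UnitInterval → List UnitInterval) → Set
Monotone A = ∀ {q p} → q ⊆ p → length (A q) ≤ length (A p)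

restrict-mono : ∀ x y {q p} → q ⊆ p → restrict x y q ⊆ restrict x y p
restrict-mono x y = filter⁺ (insideCO? x y) (insideCO? x y) (λ { refl → id })

-- The two candidates of the split point i = a + k are OUT(T^L_i) ∪ R_i ∪ OUT(A^R_i) (parts Aᴿ, mᴿ, Cᴿ)
-- and OUT(A^L_i) ∪ L_i ∪ OUT(T^R_i) (parts Aᴸ, mᴸ, Cᴸ); Tᴸ and Tᴿ are the streams of T^L_i and T^R_i.
module Candidates (f : ℕ) (a : ℤ) (d k : ℕ) where
  i : ℤ
  i = a ℤ.+ + k

  ⟨a⟩ ⟨i⟩ ⟨b⟩ : ℚ
  ⟨a⟩ = ℤtoℚ a
  ⟨i⟩ = ℤtoℚ i
  ⟨b⟩ = ℤtoℚ (a ℤ.+ + d)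

  Tᴸ Tᴿ Aᴿ Cᴿ Aᴸ Cᴸ : List UnitInterval → List UnitInterval
  mᴿ mᴸ : List UnitInterval → Maybe UnitInterval
  Tᴸ = restrict ⟨a⟩ ⟨i⟩
  Tᴿ = restrict ⟨i⟩ ⟨b⟩
  Aᴿ S = alg f a k (Tᴸ S)
  mᴿ S = Right.champion nothing (Tᴿ S)
  Cᴿ S = alg f i (d ∸ k) (Right.fed nothing (Tᴿ S))
  Aᴸ S = alg f a k (Left.fed nothing (Tᴸ S))
  mᴸ S = Left.champion nothing (Tᴸ S)
  Cᴸ S = alg f i (d ∸ k) (Tᴿ S)

  candidates : List UnitInterval → List (List UnitInterval)
  candidates S = combine (Aᴿ S) (mᴿ S) (Cᴿ S) ∷ combine (Aᴸ S) (mᴸ S) (Cᴸ S) ∷ []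

  sides≡candidates : ∀ S →
    combine (Aᴿ S) (proj₁ (rightSide ⟨i⟩ ⟨b⟩ nothing S)) (alg f i (d ∸ k) (proj₂ (rightSide ⟨i⟩ ⟨b⟩ nothing S)))
    ∷ combine (alg f a k (proj₂ (leftSide ⟨a⟩ ⟨i⟩ nothing S))) (proj₁ (leftSide ⟨a⟩ ⟨i⟩ nothing S)) (Cᴸ S)
    ∷ [] ≡ candidates S
  sides≡candidates S =
    cong₂ (λ R L → combine (Aᴿ S) (proj₁ R) (alg f i (d ∸ k) (proj₂ R))
                 ∷ combine (alg f a k (proj₂ L)) (proj₁ L) (Cᴸ S) ∷ [])
          (rightSide-restrict ⟨i⟩ ⟨b⟩ nothing S) (leftSide-restrict ⟨a⟩ ⟨i⟩ nothing S)

  candidates-unique : ∀ S → All Unique (candidates S)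
  candidates-unique S = deduplicate-! _ ∷ deduplicate-! _ ∷ []

  All-candidates : ∀ {P : UnitInterval → Set} {S} → (∀ a d {S} → All P S → All P (alg f a d S)) →
                   All P S → All (All P) (candidates S)
  All-candidates {S = S} All-alg PS =
      All-combine (All-alg a k PTᴸ) (Right.All-champion [] PTᴿ)
                  (All-alg i (d ∸ k) (All-resp-⊆ (Right.fed-⊆ nothing (Tᴿ S)) PTᴿ))
    ∷ All-combine (All-alg a k (All-resp-⊆ (Left.fed-⊆ nothing (Tᴸ S)) PTᴸ)) (Left.All-champion [] PTᴸ)
                  (All-alg i (d ∸ k) PTᴿ)
    ∷ []
    where
    PTᴸ = AllP.filter⁺ (insideCO? ⟨a⟩ ⟨i⟩) PS
    PTᴿ = AllP.filter⁺ (insideCO? ⟨i⟩ ⟨b⟩) PS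

open Candidates using (candidates; sides≡candidates; candidates-unique; All-candidates)

splitPoints : ℕ → List ℕ
splitPoints d = map suc (upTo (d ∸ 1))

alg-suc : ∀ f a d S → alg (suc f) a d S ≡ largest (concatMap (λ k → candidates f a d k S) (splitPoints d))
alg-suc f a d S = cong largest (concatMap-cong (λ k → sides≡candidates f a d k S) (splitPoints d))

All-concatMap : ∀ {A B : Set} {P : B → Set} (g : A → List B) → (∀ x → All P (g x)) → ∀ xs → All P (concatMap g xs)
All-concatMap g Pg xs = AllP.concat⁺ (AllP.map⁺ (All.universal Pg xs))

All-alg : ∀ {P : UnitInterval → Set} f a d {S} → All P S → All P (alg f a d S)
All-alg zero    a d PS = []
All-alg {P} (suc f) a d {S} PS = subst (All P) (sym (alg-suc f a d S))
  (largest-preserves [] (All-concatMap _ (λ k → All-candidates f a d k (All-alg f) PS) (splitPoints d)))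

alg-unique : ∀ f a d S → Unique (alg f a d S)
alg-unique zero    a d S = []
alg-unique (suc f) a d S = subst Unique (sym (alg-suc f a d S))
  (largest-preserves [] (All-concatMap _ (λ k → candidates-unique f a d k S) (splitPoints d)))

-- For the larger stream p the three parts of a candidate are pairwise disjoint: the parts inside [a,i)
-- and [i,b) are separated by i, and the champion is never fed.
candidates-mono : ∀ f → (∀ a d → Monotone (alg f a d)) → ∀ a d k {q p} → q ⊆ p →
  Pointwise (λ c c′ → length c ≤ length c′) (candidates f a d k q) (candidates f a d k p)
candidates-mono f alg-mono a d k {q} {p} q⊆p =
    combine-mono {Aᴿ q} {mᴿ q} {Cᴿ q} {Aᴿ p} {mᴿ p} {Cᴿ p}
      (alg-mono a k (restrict-mono ⟨a⟩ ⟨i⟩ q⊆p))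
      (Right.≼-length (Right.champion-mono (restrict-mono ⟨i⟩ ⟨b⟩ q⊆p) Right.nothing≼))
      (alg-mono i (d ∸ k) (Right.fed-mono (restrict-mono ⟨i⟩ ⟨b⟩ q⊆p) Right.nothing≼))
      (Unique.++⁺ (alg-unique f a k _)
                  (Unique.++⁺ (maybe-unique _) (alg-unique f i (d ∸ k) _) (Disjoint.sym (All∉⇒Disjoint Cᴿ∌mᴿ)))
                  (InsideCO-disjoint Aᴿ⊆ai (AllP.++⁺ mᴿ⊆ib Cᴿ⊆ib)))
  ∷ combine-mono {Aᴸ q} {mᴸ q} {Cᴸ q} {Aᴸ p} {mᴸ p} {Cᴸ p}
      (alg-mono a k (Left.fed-mono (restrict-mono ⟨a⟩ ⟨i⟩ q⊆p) Left.nothing≼))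
      (Left.≼-length (Left.champion-mono (restrict-mono ⟨a⟩ ⟨i⟩ q⊆p) Left.nothing≼))
      (alg-mono i (d ∸ k) (restrict-mono ⟨i⟩ ⟨b⟩ q⊆p))
      (subst Unique (++-assoc (Aᴸ p) _ _)
        (Unique.++⁺ (Unique.++⁺ (alg-unique f a k _) (maybe-unique _) (All∉⇒Disjoint Aᴸ∌mᴸ))
                    (alg-unique f i (d ∸ k) _)
                    (InsideCO-disjoint (AllP.++⁺ Aᴸ⊆ai mᴸ⊆ai) Cᴸ⊆ib)))
  ∷ []
  where
  open Candidates f a d k
  Tᴸ⊆ai = AllP.all-filter (insideCO? ⟨a⟩ ⟨i⟩) p
  Tᴿ⊆ib = AllP.all-filter (insideCO? ⟨i⟩ ⟨b⟩) p
  Aᴿ⊆ai = All-alg f a k Tᴸ⊆ai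
  mᴿ⊆ib = Right.All-champion [] Tᴿ⊆ib
  Cᴿ⊆ib = All-alg f i (d ∸ k) (All-resp-⊆ (Right.fed-⊆ nothing (Tᴿ p)) Tᴿ⊆ib)
  Cᴿ∌mᴿ = All-alg f i (d ∸ k) (Right.champion-∉-fed nothing (Tᴿ p))
  Aᴸ⊆ai = All-alg f a k (All-resp-⊆ (Left.fed-⊆ nothing (Tᴸ p)) Tᴸ⊆ai)
  mᴸ⊆ai = Left.All-champion [] Tᴸ⊆ai
  Cᴸ⊆ib = All-alg f i (d ∸ k) Tᴿ⊆ib
  Aᴸ∌mᴸ = All-alg f a k (Left.champion-∉-fed nothing (Tᴸ p))

alg-mono : ∀ f a d → Monotone (alg f a d)
alg-mono zero    a d _ = z≤n
alg-mono (suc f) a d {q} {p} q⊆p = begin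
  length (alg (suc f) a d q)                                  ≡⟨ cong length (alg-suc f a d q) ⟩
  length (largest (concatMap (λ k → candidates f a d k q) ks)) ≤⟨ largest-mono candidates-pointwise ⟩
  length (largest (concatMap (λ k → candidates f a d k p) ks)) ≡⟨ cong length (alg-suc f a d p) ⟨
  length (alg (suc f) a d p)                                  ∎
  where
  open ℕ.≤-Reasoning
  ks = splitPoints d
  candidates-pointwise = Pointwise.concat⁺ (Pointwise.map⁺ _ _
    (Pointwise.refl (λ {k} → candidates-mono f (alg-mono f) a d k q⊆p) {ks}))

-- Averages over orderings

sum-map-concatMap : ∀ {A B : Set} (F : B → ℕ) (g : A → List B) xs →
  sum (map F (concatMap g xs)) ≡ sum (map (λ x → sum (map F (g x))) xs)
sum-map-concatMap F g []       = refl
sum-map-concatMap F g (x ∷ xs) = begin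
  sum (map F (g x ++ concatMap g xs))             ≡⟨ cong sum (map-++ F (g x) _) ⟩
  sum (map F (g x) ++ map F (concatMap g xs))     ≡⟨ sum-++ (map F (g x)) _ ⟩
  sum (map F (g x)) + sum (map F (concatMap g xs))
    ≡⟨ cong (λ n → sum (map F (g x)) + n) (sum-map-concatMap F g xs) ⟩
  sum (map F (g x)) + sum (map (λ x → sum (map F (g x))) xs) ∎
  where open ≡-Reasoning

sum-map-+ : ∀ {A : Set} (F G : A → ℕ) xs → sum (map (λ x → F x + G x) xs) ≡ sum (map F xs) + sum (map G xs)
sum-map-+ F G []       = refl
sum-map-+ F G (x ∷ xs) rewrite sum-map-+ F G xs = +-interchange (F x) (G x) _ _

sum-map-* : ∀ {A : Set} c (F : A → ℕ) xs → sum (map (λ x → c * F x) xs) ≡ c * sum (map F xs)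
sum-map-* c F []       = sym (ℕ.*-zeroʳ c)
sum-map-* c F (x ∷ xs) rewrite sum-map-* c F xs = sym (ℕ.*-distribˡ-+ c (F x) _)

sum-map-congᴬ : ∀ {A : Set} {F G : A → ℕ} {xs} → All (λ x → F x ≡ G x) xs → sum (map F xs) ≡ sum (map G xs)
sum-map-congᴬ = cong sum ∘ map-cong-local

sum-map-const : ∀ {A : Set} {F : A → ℕ} {c} {xs} → All (λ x → F x ≡ c) xs → sum (map F xs) ≡ length xs * c
sum-map-const []         = refl
sum-map-const (Fx≡c ∷ h) = cong₂ _+_ Fx≡c (sum-map-const h)

sum-map-mono : ∀ {A : Set} {F G : A → ℕ} → (∀ x → F x ≤ G x) → ∀ xs → sum (map F xs) ≤ sum (map G xs)
sum-map-mono F≤G []       = z≤n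
sum-map-mono F≤G (x ∷ xs) = ℕ.+-mono-≤ (F≤G x) (sum-map-mono F≤G xs)

length≡sum-ones : ∀ {A : Set} (xs : List A) → length xs ≡ sum (map (λ _ → 1) xs)
length≡sum-ones []       = refl
length≡sum-ones (x ∷ xs) = cong suc (length≡sum-ones xs)

module _ {A : Set} where

  sumOverOrderings : (List A → ℕ) → List A → ℕ
  sumOverOrderings F xs = sum (map F (orderings xs))

  sumOverInsertions : A → (List A → ℕ) → List A → ℕ
  sumOverInsertions x F l = sum (map F (insertAll x l))

  sumOverOrderings-∷ : ∀ F x xs → sumOverOrderings F (x ∷ xs) ≡ sumOverOrderings (sumOverInsertions x F) xs
  sumOverOrderings-∷ F x xs = sum-map-concatMap F (insertAll x) (orderings xs)

  sumOverInsertions-∷ : ∀ x F z zs →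
    sumOverInsertions x F (z ∷ zs) ≡ F (x ∷ z ∷ zs) + sumOverInsertions x (F ∘ (z ∷_)) zs
  sumOverInsertions-∷ x F z zs = cong (λ n → F (x ∷ z ∷ zs) + sum n) (sym (map-∘ (insertAll x zs)))

  sumOverInsertions-cong : ∀ x {G H} → (∀ l → G l ≡ H l) → ∀ l → sumOverInsertions x G l ≡ sumOverInsertions x H l
  sumOverInsertions-cong x G≗H l = cong sum (map-cong G≗H (insertAll x l))

  sumOverInsertions-+ : ∀ x G H l →
    sumOverInsertions x (λ m → G m + H m) l ≡ sumOverInsertions x G l + sumOverInsertions x H l
  sumOverInsertions-+ x G H l = sum-map-+ G H (insertAll x l)

  -- Expanding the insertions at the first two positions leaves the same five terms on both sides,
  -- the last one by induction.
  sumOverInsertions-comm : ∀ x y F l →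
    sumOverInsertions y (sumOverInsertions x F) l ≡ sumOverInsertions x (sumOverInsertions y F) l
  sumOverInsertions-comm x y F [] = cong (_+ 0) (+-comm-middle (F (x ∷ y ∷ [])) (F (y ∷ x ∷ [])))
    where
    +-comm-middle : ∀ a b → a + (b + 0) ≡ b + (a + 0)
    +-comm-middle = solve-∀
  sumOverInsertions-comm x y F (z ∷ zs) = begin
    sumOverInsertions y (sumOverInsertions x F) (z ∷ zs)              ≡⟨ expand x y ⟩
    (a + (b + c)) + (d + sumOverInsertions y (sumOverInsertions x Fz) zs) ≡⟨ cong (λ e → (a + (b + c)) + (d + e)) IH ⟩
    (a + (b + c)) + (d + sumOverInsertions x (sumOverInsertions y Fz) zs) ≡⟨ rearrange a b c d _ ⟩
    (b + (a + d)) + (c + sumOverInsertions x (sumOverInsertions y Fz) zs) ≡⟨ expand y x ⟨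
    sumOverInsertions x (sumOverInsertions y F) (z ∷ zs)              ∎
    where
    open ≡-Reasoning
    Fz = F ∘ (z ∷_)
    IH = sumOverInsertions-comm x y Fz zs
    a = F (x ∷ y ∷ z ∷ zs)
    b = F (y ∷ x ∷ z ∷ zs)
    c = sumOverInsertions x (λ m → F (y ∷ z ∷ m)) zs
    d = sumOverInsertions y (λ m → F (x ∷ z ∷ m)) zs
    rearrange : ∀ a b c d e → (a + (b + c)) + (d + e) ≡ (b + (a + d)) + (c + e)
    rearrange = solve-∀
    expand : ∀ x y → sumOverInsertions y (sumOverInsertions x F) (z ∷ zs) ≡
      (F (x ∷ y ∷ z ∷ zs) + (F (y ∷ x ∷ z ∷ zs) + sumOverInsertions x (λ m → F (y ∷ z ∷ m)) zs))
        + (sumOverInsertions y (λ m → F (x ∷ z ∷ m)) zs + sumOverInsertions y (sumOverInsertions x Fz) zs)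
    expand x y = begin
      sumOverInsertions y (sumOverInsertions x F) (z ∷ zs)
        ≡⟨ sumOverInsertions-∷ y (sumOverInsertions x F) z zs ⟩
      sumOverInsertions x F (y ∷ z ∷ zs) + sumOverInsertions y (λ m → sumOverInsertions x F (z ∷ m)) zs
        ≡⟨ cong₂ _+_ (trans (sumOverInsertions-∷ x F y (z ∷ zs))
                            (cong (λ n → F (x ∷ y ∷ z ∷ zs) + n) (sumOverInsertions-∷ x (F ∘ (y ∷_)) z zs)))
                     (trans (sumOverInsertions-cong y (sumOverInsertions-∷ x F z) zs)
                            (sumOverInsertions-+ y (λ m → F (x ∷ z ∷ m)) (sumOverInsertions x Fz) zs)) ⟩
      (F (x ∷ y ∷ z ∷ zs) + (F (y ∷ x ∷ z ∷ zs) + sumOverInsertions x (λ m → F (y ∷ z ∷ m)) zs))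
        + (sumOverInsertions y (λ m → F (x ∷ z ∷ m)) zs + sumOverInsertions y (sumOverInsertions x Fz) zs) ∎

  sumOverOrderings-↭ : ∀ {xs ys} → xs ↭ ys → ∀ F → sumOverOrderings F xs ≡ sumOverOrderings F ys
  sumOverOrderings-↭ ↭.refl F = refl
  sumOverOrderings-↭ (↭.prep {xs} {ys} x xs↭ys) F = begin
    sumOverOrderings F (x ∷ xs)                       ≡⟨ sumOverOrderings-∷ F x xs ⟩
    sumOverOrderings (sumOverInsertions x F) xs      ≡⟨ sumOverOrderings-↭ xs↭ys _ ⟩
    sumOverOrderings (sumOverInsertions x F) ys      ≡⟨ sumOverOrderings-∷ F x ys ⟨
    sumOverOrderings F (x ∷ ys)                       ∎
    where open ≡-Reasoning
  sumOverOrderings-↭ (↭.swap {xs} {ys} x y xs↭ys) F = begin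
    sumOverOrderings F (x ∷ y ∷ xs)                                           ≡⟨ sumOverOrderings-∷ F x (y ∷ xs) ⟩
    sumOverOrderings (sumOverInsertions x F) (y ∷ xs)                         ≡⟨ sumOverOrderings-∷ _ y xs ⟩
    sumOverOrderings (sumOverInsertions y (sumOverInsertions x F)) xs
      ≡⟨ cong sum (map-cong-local (All.universal (sumOverInsertions-comm x y F) (orderings xs))) ⟩
    sumOverOrderings (sumOverInsertions x (sumOverInsertions y F)) xs         ≡⟨ sumOverOrderings-↭ xs↭ys _ ⟩
    sumOverOrderings (sumOverInsertions x (sumOverInsertions y F)) ys         ≡⟨ sumOverOrderings-∷ _ x ys ⟨
    sumOverOrderings (sumOverInsertions y F) (x ∷ ys)                         ≡⟨ sumOverOrderings-∷ F y (x ∷ ys) ⟨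
    sumOverOrderings F (y ∷ x ∷ ys)                                           ∎
    where open ≡-Reasoning
  sumOverOrderings-↭ (↭.trans xs↭ys ys↭zs) F = trans (sumOverOrderings-↭ xs↭ys F) (sumOverOrderings-↭ ys↭zs F)

  insertAll-↭ : ∀ (x : A) l → All (_↭ x ∷ l) (insertAll x l)
  insertAll-↭ x []       = ↭-refl ∷ []
  insertAll-↭ x (z ∷ zs) =
    ↭-refl ∷ AllP.map⁺ (All.map (λ l↭x∷zs → ↭-trans (↭-prep z l↭x∷zs) (↭-swap z x ↭-refl)) (insertAll-↭ x zs))

  orderings-↭ : ∀ xs → All (_↭ xs) (orderings xs)
  orderings-↭ []       = ↭-refl ∷ []
  orderings-↭ (x ∷ xs) = AllP.concat⁺ (AllP.map⁺
    (All.map (λ {l} l↭xs → All.map (λ l′↭x∷l → ↭-trans l′↭x∷l (↭-prep x l↭xs)) (insertAll-↭ x l)) (orderings-↭ xs)))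

  length-insertAll : ∀ (x : A) l → length (insertAll x l) ≡ suc (length l)
  length-insertAll x []       = refl
  length-insertAll x (z ∷ zs) = cong suc (trans (length-map (z ∷_) (insertAll x zs)) (length-insertAll x zs))

  orderings-nonempty : ∀ (xs : List A) → 0 < length (orderings xs)
  orderings-nonempty []       = s≤s z≤n
  orderings-nonempty (x ∷ xs) with orderings xs | orderings-nonempty xs
  ... | l ∷ _ | _ =
    ℕ.≤-trans (s≤s z≤n) (ℕ.≤-trans (ℕ.≤-reflexive (sym (length-insertAll x l))) (length-++-≤ˡ (insertAll x l)))

  module _ {P : Pred A 0ℓ} (P? : Decidable P) where

    filter-↭-partition : ∀ xs → xs ↭ filter (∁? P?) xs ++ filter P? xs
    filter-↭-partition []       = ↭-refl
    filter-↭-partition (x ∷ xs) with P? x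
    ... | yes _ = ↭-trans (↭-prep x (filter-↭-partition xs)) (↭-sym (shift x (filter (∁? P?) xs) (filter P? xs)))
    ... | no  _ = ↭-prep x (filter-↭-partition xs)

    insertAll-filter-reject : ∀ {y} → ¬ P y → ∀ l → All (λ l′ → filter P? l′ ≡ filter P? l) (insertAll y l)
    insertAll-filter-reject ¬Py []       = filter-reject P? ¬Py ∷ []
    insertAll-filter-reject ¬Py (z ∷ zs) =
      filter-reject P? ¬Py ∷ AllP.map⁺ (All.map (filter-∷-cong z) (insertAll-filter-reject ¬Py zs))
      where
      filter-∷-cong : ∀ z {l l′} → filter P? l ≡ filter P? l′ → filter P? (z ∷ l) ≡ filter P? (z ∷ l′)
      filter-∷-cong z eq with P? z
      ... | yes _ = cong (z ∷_) eq
      ... | no  _ = eq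

    sumOverOrderings-reject : ∀ F {y} → ¬ P y → ∀ ys →
      sumOverOrderings (F ∘ filter P?) (y ∷ ys) ≡ suc (length ys) * sumOverOrderings (F ∘ filter P?) ys
    sumOverOrderings-reject F {y} ¬Py ys = begin
      sumOverOrderings (F ∘ filter P?) (y ∷ ys)                       ≡⟨ sumOverOrderings-∷ _ y ys ⟩
      sumOverOrderings (sumOverInsertions y (F ∘ filter P?)) ys
        ≡⟨ sum-map-congᴬ {G = λ l → suc (length ys) * F (filter P? l)} (All.map insertions (orderings-↭ ys)) ⟩
      sum (map (λ l → suc (length ys) * F (filter P? l)) (orderings ys))
        ≡⟨ sum-map-* (suc (length ys)) _ (orderings ys) ⟩
      suc (length ys) * sumOverOrderings (F ∘ filter P?) ys            ∎
      where
      open ≡-Reasoning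
      insertions : ∀ {l} → l ↭ ys → sumOverInsertions y (F ∘ filter P?) l ≡ suc (length ys) * F (filter P? l)
      insertions {l} l↭ys = begin
        sumOverInsertions y (F ∘ filter P?) l ≡⟨ sum-map-const (All.map (cong F) (insertAll-filter-reject ¬Py l)) ⟩
        length (insertAll y l) * F (filter P? l) ≡⟨ cong (λ n → n * F (filter P? l)) (length-insertAll y l) ⟩
        suc (length l) * F (filter P? l)       ≡⟨ cong (λ n → suc n * F (filter P? l)) (↭-length l↭ys) ⟩
        suc (length ys) * F (filter P? l)      ∎

    sumOverOrderings-reject-prefix : ∀ {N} → All (∁ P) N → ∀ M →
      ∃[ K ] ∀ F → sumOverOrderings (F ∘ filter P?) (N ++ M) ≡ K * sumOverOrderings (F ∘ filter P?) M
    sumOverOrderings-reject-prefix []                  M = 1 , λ F → sym (ℕ.*-identityˡ _)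
    sumOverOrderings-reject-prefix {y ∷ N} (¬Py ∷ ¬PN) M =
      let K , prefix = sumOverOrderings-reject-prefix ¬PN M in
      suc (length (N ++ M)) * K , λ F → trans (sumOverOrderings-reject F ¬Py (N ++ M))
        (trans (cong (suc (length (N ++ M)) *_) (prefix F)) (sym (ℕ.*-assoc (suc (length (N ++ M))) K _)))

    -- Move the elements outside P to the front; inserting each of them multiplies the sum by the
    -- number of insertion positions, whatever F is.
    sumOverOrderings-filter : ∀ xs →
      ∃[ K ] ∀ F → sumOverOrderings (F ∘ filter P?) xs ≡ K * sumOverOrderings F (filter P? xs)
    sumOverOrderings-filter xs =
      let K , prefix = sumOverOrderings-reject-prefix (AllP.all-filter (∁? P?) xs) M in
      K , λ F → begin
        sumOverOrderings (F ∘ filter P?) xs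
          ≡⟨ sumOverOrderings-↭ (filter-↭-partition xs) _ ⟩
        sumOverOrderings (F ∘ filter P?) (filter (∁? P?) xs ++ M)     ≡⟨ prefix F ⟩
        K * sumOverOrderings (F ∘ filter P?) M
          ≡⟨ cong (K *_) (sum-map-congᴬ (All.map (filter-id F) (orderings-↭ M))) ⟩
        K * sumOverOrderings F M                                      ∎
      where
      open ≡-Reasoning
      M = filter P? xs
      filter-id : ∀ F {l} → l ↭ M → F (filter P? l) ≡ F l
      filter-id F l↭M = cong F (filter-all P? (All-resp-↭ (↭-sym l↭M) (AllP.all-filter P? xs)))

fromℚᵘ-mono-≤ : ∀ {p q} → p ℚᵘ.≤ q → ℚ.fromℚᵘ p ≤ℚ ℚ.fromℚᵘ q
fromℚᵘ-mono-≤ {p} {q} p≤q = ℚ.toℚᵘ-cancel-≤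
  (ℚᵘ.≤-respˡ-≃ (ℚᵘ.≃-sym (ℚ.toℚᵘ-fromℚᵘ p)) (ℚᵘ.≤-respʳ-≃ (ℚᵘ.≃-sym (ℚ.toℚᵘ-fromℚᵘ q)) p≤q))

mean-scale : ∀ K (L M : List ℕ) → 0 < length L →
  sum L ≡ K * sum M → length L ≡ K * length M → mean L ≡ mean M
mean-scale K (x ∷ xs) []       _ _     |L|≡ = contradiction (trans |L|≡ (ℕ.*-zeroʳ K)) λ ()
mean-scale K (x ∷ xs) (y ∷ ys) _ ΣL≡ |L|≡ =
  ℚ.fromℚᵘ-cong {mkℚᵘ (+ ΣL) (length xs)} {mkℚᵘ (+ ΣM) (length ys)} (*≡* (begin
  + ΣL ℤ.* + |M|  ≡⟨ ℤ.pos-* ΣL |M| ⟨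
  + (ΣL * |M|)    ≡⟨ cong +_ cross ⟩
  + (ΣM * |L|)    ≡⟨ ℤ.pos-* ΣM |L| ⟩
  + ΣM ℤ.* + |L|  ∎))
  where
  open ≡-Reasoning
  ΣL = sum (x ∷ xs)
  ΣM = sum (y ∷ ys)
  |L| = length (x ∷ xs)
  |M| = length (y ∷ ys)
  cross : ΣL * |M| ≡ ΣM * |L|
  cross = begin
    ΣL * |M|         ≡⟨ cong (_* |M|) ΣL≡ ⟩
    K * ΣM * |M|     ≡⟨ cong (_* |M|) (ℕ.*-comm K ΣM) ⟩
    ΣM * K * |M|     ≡⟨ ℕ.*-assoc ΣM K |M| ⟩
    ΣM * (K * |M|)   ≡⟨ cong (ΣM *_) |L|≡ ⟨
    ΣM * |L|         ∎

mean-≤ : ∀ (L M : List ℕ) → 0 < length L → 0 < length M →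
  sum L * length M ≤ sum M * length L → mean L ≤ℚ mean M
mean-≤ (x ∷ xs) (y ∷ ys) _ _ cross = fromℚᵘ-mono-≤ {mkℚᵘ (+ ΣL) (length xs)} {mkℚᵘ (+ ΣM) (length ys)}
  (*≤* (subst₂ ℤ._≤_ (ℤ.pos-* ΣL (suc (length ys))) (ℤ.pos-* ΣM (suc (length xs))) (ℤ.+≤+ cross)))
  where
  ΣL = sum (x ∷ xs)
  ΣM = sum (y ∷ ys)

mean-mono : ∀ {A : Set} {F G : A → ℕ} → (∀ x → F x ≤ G x) → ∀ xs → mean (map F xs) ≤ℚ mean (map G xs)
mean-mono F≤G []       = ℚ.≤-refl
mean-mono {F = F} {G} F≤G xs@(_ ∷ _) = mean-≤ (map F xs) (map G xs) (s≤s z≤n) (s≤s z≤n) (begin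
  sum (map F xs) * length (map G xs) ≡⟨ cong (sum (map F xs) *_) (length-map G xs) ⟩
  sum (map F xs) * length xs         ≤⟨ ℕ.*-monoˡ-≤ (length xs) (sum-map-mono F≤G xs) ⟩
  sum (map G xs) * length xs         ≡⟨ cong (sum (map G xs) *_) (length-map F xs) ⟨
  sum (map G xs) * length (map F xs) ∎)
  where open ℕ.≤-Reasoning

average : ∀ {A : Set} → (List A → ℕ) → List A → ℚ
average F xs = mean (map F (orderings xs))

average-mono : ∀ {A : Set} {F G : List A → ℕ} → (∀ l → F l ≤ G l) → ∀ xs → average F xs ≤ℚ average G xs
average-mono F≤G xs = mean-mono F≤G (orderings xs)

average-filter : ∀ {A : Set} {P : Pred A 0ℓ} (P? : Decidable P) (F : List A → ℕ) {xs ys} →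
  ys ↭ filter P? xs → average (F ∘ filter P?) xs ≡ average F ys
average-filter P? F {xs} {ys} ys↭ =
  mean-scale K (map (F ∘ filter P?) (orderings xs)) (map F (orderings ys))
    (ℕ.≤-trans (orderings-nonempty xs) (ℕ.≤-reflexive (sym (length-map _ (orderings xs)))))
    (trans (scale F) (cong (K *_) (sumOverOrderings-↭ (↭-sym ys↭) F)))
    (begin
      length (map (F ∘ filter P?) (orderings xs)) ≡⟨ length-map _ (orderings xs) ⟩
      length (orderings xs)                       ≡⟨ length≡sum-ones (orderings xs) ⟩
      sumOverOrderings (λ _ → 1) xs               ≡⟨ scale (λ _ → 1) ⟩
      K * sumOverOrderings (λ _ → 1) (filter P? xs) ≡⟨ cong (K *_) (sumOverOrderings-↭ (↭-sym ys↭) _) ⟩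
      K * sumOverOrderings (λ _ → 1) ys            ≡⟨ cong (K *_) (length≡sum-ones (orderings ys)) ⟨
      K * length (orderings ys)                   ≡⟨ cong (K *_) (length-map F (orderings ys)) ⟨
      K * length (map F (orderings ys))           ∎)
  where
  open ≡-Reasoning
  K = proj₁ (sumOverOrderings-filter P? xs)
  scale = proj₂ (sumOverOrderings-filter P? xs)

↭-filter-∈ : ∀ {xs ys} → Unique xs → Unique ys → All (_∈ xs) ys → ys ↭ filter (_∈? ys) xs
↭-filter-∈ {xs} {ys} xs! ys! ys⊆xs = ∼bag⇒↭ (unique∧set⇒bag ys! (Unique.filter⁺ (_∈? ys) xs!)
  (mk⇔ (λ v∈ys → ∈-filter⁺ (_∈? ys) (All.lookup ys⊆xs v∈ys) v∈ys) (proj₂ ∘ ∈-filter⁻ (_∈? ys) {xs = xs})))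

algorithmA-mono : ∀ a b → Monotone (algorithmA a b)
algorithmA-mono a b = alg-mono ℤ.∣ b ℤ.- a ∣ a ℤ.∣ b ℤ.- a ∣

mainTheorem4 : (Δ : ℕ) → 1 ≤ Δ →
    (𝓘 OPT : List UnitInterval) →
    Unique 𝓘 →
    All (InsideCO (ℤtoℚ (+ 0)) (ℤtoℚ (+ Δ))) 𝓘 →
    MaximumIndependentSubset 𝓘 OPT →
    expectedOut (algorithmA -[1+ 0 ] (+ (Δ + 1))) OPT
      ≤ℚ expectedOut (algorithmA -[1+ 0 ] (+ (Δ + 1))) 𝓘
mainTheorem4 Δ _ 𝓘 OPT 𝓘! _ ((OPT! , OPT⊆𝓘 , _) , _) = begin
  average (length ∘ 𝒜) OPT
    ≡⟨ average-filter (_∈? OPT) (length ∘ 𝒜) {𝓘} (↭-filter-∈ 𝓘! OPT! OPT⊆𝓘) ⟨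
  average (length ∘ 𝒜 ∘ filter (_∈? OPT)) 𝓘
    ≤⟨ average-mono (λ S → algorithmA-mono -[1+ 0 ] (+ (Δ + 1)) (filter-⊆ (_∈? OPT) S)) 𝓘 ⟩
  average (length ∘ 𝒜) 𝓘 ∎
  where
  open ℚ.≤-Reasoning
  𝒜 = algorithmA -[1+ 0 ] (+ (Δ + 1))
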